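{- For every modal formula $A$ over $P$, if $\vdash_{\mathsf{K}}A$, then $\vdash_{\mathsf{BFNL^*}}\ \Rightarrow A^\dagger$.
   Context: Modal formulas over a set $P$ of letters: $A::=p\mid\bot\mid A\wedge B\mid A\vee B\mid A\supset B\mid\Diamond A$, with $\neg A:=A\supset\bot$, $\Box A:=\neg\Diamond\neg A$; $\mathsf{K}$ is axiomatized by all instances of propositional tautologies, $\Box(A\supset B)\supset(\Box A\supset\Box B)$, modus ponens and necessitation. For a distinguished letter $m\notin P$, $(\cdot)^\dagger$: $p^\dagger=p$, $\bot^\dagger=\bot$, $(A\wedge B)^\dagger=A^\dagger\wedge B^\dagger$, $(A\vee B)^\dagger=A^\dagger\vee B^\dagger$, $(A\supset B)^\dagger=\neg A^\dagger\vee B^\dagger$, $(\Diamond A)^\dagger=m\cdot A^\dagger$. $\mathsf{BFNL^*}$: formulas $A::=p\mid\top\mid\bot\mid\neg A\mid A\wedge B\mid A\vee B\mid A\cdot B\mid A\backslash B\mid A/B$; formula trees $\Gamma::=A\mid\Gamma\circ\Delta$ ($\Gamma[\Delta]$: distinguished subtree occurrence); sequents $\Gamma\Rightarrow A$ with $\Gamma$ a tree or empty. Axioms: $A\Rightarrow A$; $A\wedge(B\vee C)\Rightarrow(A\wedge B)\vee(A\wedge C)$; $\Gamma[\bot]\Rightarrow A$; $\Gamma\Rightarrow\top$ ($\Gamma$ possibly empty); $A\wedge\neg A\Rightarrow\bot$; $\top\Rightarrow A\vee\neg A$. Rules: from $\Delta\Rightarrow A$, $\Gamma[B]\Rightarrow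 C$ infer $\Gamma[\Delta\circ(A\backslash B)]\Rightarrow C$; from $A\circ\Gamma\Rightarrow B$ infer $\Gamma\Rightarrow A\backslash B$; from $\Gamma[A]\Rightarrow C$, $\Delta\Rightarrow B$ infer $\Gamma[(A/B)\circ\Delta]\Rightarrow C$; from $\Gamma\circ B\Rightarrow A$ infer $\Gamma\Rightarrow A/B$ ($\Gamma$ may be empty in these two); from $\Gamma[A\circ B]\Rightarrow C$ infer $\Gamma[A\cdot B]\Rightarrow C$; from $\Gamma\Rightarrow A$, $\Delta\Rightarrow B$ infer $\Gamma\circ\Delta\Rightarrow A\cdot B$; Cut: from $\Delta\Rightarrow A$, $\Gamma[A]\Rightarrow B$ infer $\Gamma[\Delta]\Rightarrow B$; from $\Gamma[A_i]\Rightarrow B$ infer $\Gamma[A_1\wedge A_2]\Rightarrow B$; from $\Gamma\Rightarrow A$, $\Gamma\Rightarrow B$ infer $\Gamma\Rightarrow A\wedge B$; from $\Gamma[A_1]\Rightarrow B$, $\Gamma[A_2]\Rightarrow B$ infer $\Gamma[A_1\vee A_2]\Rightarrow B$; from $\Gamma\Rightarrow A_i$ infer $\Gamma\Rightarrow A_1\vee A_2$. -}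

module Defs where

open import Data.Nat using (ℕ)
open import Data.Bool using (Bool; true; false; _∧_; _∨_; not)
open import Data.Maybe using (Maybe; just; nothing)
open import Relation.Binary.PropositionalEquality using (_≡_)

infixr 6 _∧ₘ_
infixr 5 _∨ₘ_
infixr 4 _⊃ₘ_

data MFm (P : Set) : Set where
  var  : P → MFm P
  ⊥ₘ   : MFm P
  _∧ₘ_ : MFm P → MFm P → MFm P
  _∨ₘ_ : MFm P → MFm P → MFm P
  _⊃ₘ_ : MFm P → MFm P → MFm P
  ◇    : MFm P → MFm P

module _ {P : Set} where
  ¬ₘ_ : MFm P → MFm P
  ¬ₘ A = A ⊃ₘ ⊥ₘ

  □ : MFm P → MFm P
  □ A = ¬ₘ (◇ (¬ₘ A))

data PFm : Set where
  pvar  : ℕ → PFm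
  p⊥    : PFm
  _p∧_  : PFm → PFm → PFm
  _p∨_  : PFm → PFm → PFm
  _p⊃_  : PFm → PFm → PFm

⟦_⟧ : PFm → (ℕ → Bool) → Bool
⟦ pvar n ⟧ v = v n
⟦ p⊥ ⟧ v = false
⟦ φ p∧ ψ ⟧ v = ⟦ φ ⟧ v ∧ ⟦ ψ ⟧ v
⟦ φ p∨ ψ ⟧ v = ⟦ φ ⟧ v ∨ ⟦ ψ ⟧ v
⟦ φ p⊃ ψ ⟧ v = not (⟦ φ ⟧ v) ∨ ⟦ ψ ⟧ v

Tautology : PFm → Set
Tautology φ = (v : ℕ → Bool) → ⟦ φ ⟧ v ≡ true

_[_] : {P : Set} → PFm → (ℕ → MFm P) → MFm P
pvar n [ σ ] = σ n
p⊥ [ σ ] = ⊥ₘ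
(φ p∧ ψ) [ σ ] = (φ [ σ ]) ∧ₘ (ψ [ σ ])
(φ p∨ ψ) [ σ ] = (φ [ σ ]) ∨ₘ (ψ [ σ ])
(φ p⊃ ψ) [ σ ] = (φ [ σ ]) ⊃ₘ (ψ [ σ ])

data ⊢K_ {P : Set} : MFm P → Set where
  taut : (φ : PFm) → Tautology φ → (σ : ℕ → MFm P) → ⊢K (φ [ σ ])
  kax  : (A B : MFm P) → ⊢K (□ (A ⊃ₘ B) ⊃ₘ (□ A ⊃ₘ □ B))
  mp   : {A B : MFm P} → ⊢K A → ⊢K (A ⊃ₘ B) → ⊢K B
  nec  : {A : MFm P} → ⊢K A → ⊢K (□ A)

data Letter (P : Set) : Set where
  ltr : P → Letter P
  m   : Letter P

infixr 7 _·_
infixr 6 _∧ᵇ_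
infixr 5 _∨ᵇ_

data BFm (Q : Set) : Set where
  atom : Q → BFm Q
  ⊤ᵇ   : BFm Q
  ⊥ᵇ   : BFm Q
  ¬ᵇ_  : BFm Q → BFm Q
  _∧ᵇ_ : BFm Q → BFm Q → BFm Q
  _∨ᵇ_ : BFm Q → BFm Q → BFm Q
  _·_  : BFm Q → BFm Q → BFm Q
  _∖_  : BFm Q → BFm Q → BFm Q
  _╱_  : BFm Q → BFm Q → BFm Q

infixl 4 _∘_
data Tree (Q : Set) : Set where
  leaf : BFm Q → Tree Q
  _∘_  : Tree Q → Tree Q → Tree Q

data Ctx (Q : Set) : Set where
  hole : Ctx Q
  _∘ₗ_ : Ctx Q → Tree Q → Ctx Q
  _∘ᵣ_ : Tree Q → Ctx Q → Ctx Q

_⟨_⟩ : {Q : Set} → Ctx Q → Tree Q → Tree Q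
hole ⟨ Δ ⟩ = Δ
(Γ ∘ₗ T) ⟨ Δ ⟩ = (Γ ⟨ Δ ⟩) ∘ T
(T ∘ᵣ Γ) ⟨ Δ ⟩ = T ∘ (Γ ⟨ Δ ⟩)

_⟨_⟩ᶠ : {Q : Set} → Ctx Q → BFm Q → Tree Q
Γ ⟨ A ⟩ᶠ = Γ ⟨ leaf A ⟩

Ante : Set → Set
Ante Q = Maybe (Tree Q)

_∘?_ : {Q : Set} → BFm Q → Ante Q → Tree Q
A ∘? nothing = leaf A
A ∘? just Γ = leaf A ∘ Γ

_?∘_ : {Q : Set} → Ante Q → BFm Q → Tree Q
nothing ?∘ B = leaf B
just Γ ?∘ B = Γ ∘ leaf B

infix 2 _⊢_
data _⊢_ {Q : Set} : Ante Q → BFm Q → Set where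
  id      : (A : BFm Q) → just (leaf A) ⊢ A
  distr   : (A B C : BFm Q) →
            just (leaf (A ∧ᵇ (B ∨ᵇ C))) ⊢ (A ∧ᵇ B) ∨ᵇ (A ∧ᵇ C)
  ⊥L      : (Γ : Ctx Q) (A : BFm Q) → just (Γ ⟨ ⊥ᵇ ⟩ᶠ) ⊢ A
  ⊤R      : (Γ : Ante Q) → Γ ⊢ ⊤ᵇ
  contra  : (A : BFm Q) → just (leaf (A ∧ᵇ ¬ᵇ A)) ⊢ ⊥ᵇ
  lem     : (A : BFm Q) → just (leaf ⊤ᵇ) ⊢ A ∨ᵇ ¬ᵇ A
  ∖L      : {Γ : Ctx Q} {Δ : Tree Q} {A B C : BFm Q} →
            just Δ ⊢ A → just (Γ ⟨ B ⟩ᶠ) ⊢ C →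
            just (Γ ⟨ Δ ∘ leaf (A ∖ B) ⟩) ⊢ C
  ∖R      : {Γ : Ante Q} {A B : BFm Q} →
            just (A ∘? Γ) ⊢ B → Γ ⊢ A ∖ B
  ╱L      : {Γ : Ctx Q} {Δ : Tree Q} {A B C : BFm Q} →
            just (Γ ⟨ A ⟩ᶠ) ⊢ C → just Δ ⊢ B →
            just (Γ ⟨ leaf (A ╱ B) ∘ Δ ⟩) ⊢ C
  ╱R      : {Γ : Ante Q} {A B : BFm Q} →
            just (Γ ?∘ B) ⊢ A → Γ ⊢ A ╱ B
  ·L      : {Γ : Ctx Q} {A B C : BFm Q} →
            just (Γ ⟨ leaf A ∘ leaf B ⟩) ⊢ C → just (Γ ⟨ A · B ⟩ᶠ) ⊢ C
  ·R      : {Γ Δ : Tree Q} {A B : BFm Q} →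
            just Γ ⊢ A → just Δ ⊢ B → just (Γ ∘ Δ) ⊢ A · B
  cut     : {Γ : Ctx Q} {Δ : Tree Q} {A B : BFm Q} →
            just Δ ⊢ A → just (Γ ⟨ A ⟩ᶠ) ⊢ B → just (Γ ⟨ Δ ⟩) ⊢ B
  -- cut with empty Δ: only meaningful when Γ[ ] is the bare hole
  cut∅    : {A B : BFm Q} → nothing ⊢ A → just (leaf A) ⊢ B → nothing ⊢ B
  ∧L₁     : {Γ : Ctx Q} {A₁ A₂ B : BFm Q} →
            just (Γ ⟨ A₁ ⟩ᶠ) ⊢ B → just (Γ ⟨ A₁ ∧ᵇ A₂ ⟩ᶠ) ⊢ B
  ∧L₂     : {Γ : Ctx Q} {A₁ A₂ B : BFm Q} →
            just (Γ ⟨ A₂ ⟩ᶠ) ⊢ B → just (Γ ⟨ A₁ ∧ᵇ A₂ ⟩ᶠ) ⊢ B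
  ∧R      : {Γ : Ante Q} {A B : BFm Q} → Γ ⊢ A → Γ ⊢ B → Γ ⊢ A ∧ᵇ B
  ∨L      : {Γ : Ctx Q} {A₁ A₂ B : BFm Q} →
            just (Γ ⟨ A₁ ⟩ᶠ) ⊢ B → just (Γ ⟨ A₂ ⟩ᶠ) ⊢ B →
            just (Γ ⟨ A₁ ∨ᵇ A₂ ⟩ᶠ) ⊢ B
  ∨R₁     : {Γ : Ante Q} {A₁ A₂ : BFm Q} → Γ ⊢ A₁ → Γ ⊢ A₁ ∨ᵇ A₂
  ∨R₂     : {Γ : Ante Q} {A₁ A₂ : BFm Q} → Γ ⊢ A₂ → Γ ⊢ A₁ ∨ᵇ A₂

⊢BFNL*_ : {Q : Set} → BFm Q → Set
⊢BFNL* A = nothing ⊢ A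

_† : {P : Set} → MFm P → BFm (Letter P)
var p † = atom (ltr p)
⊥ₘ † = ⊥ᵇ
(A ∧ₘ B) † = (A †) ∧ᵇ (B †)
(A ∨ₘ B) † = (A †) ∨ᵇ (B †)
(A ⊃ₘ B) † = (¬ᵇ (A †)) ∨ᵇ (B †)
◇ A † = atom m · (A †)

-- The antecedent-free part of BFNL* contains a Boolean algebra: the sequents A ⇒ B order
-- the formulas, and the axioms for ∧, ∨, ⊥, ⊤, distributivity, contradiction and excluded
-- middle make ¬ a Boolean complement. So every instance of a tautology is above ⊤ (Kalmár's
-- argument), and modus ponens is Boolean. The modality ◇ becomes m · _, which is monotone,
-- distributes over ∨ and annihilates ⊥; this validates the K axiom and necessitation.
-- Hence ⊤ ⇒ A† for every theorem A of K, and a cut with ⇒ ⊤ empties the antecedent.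
module Submission where

open import Defs
open import Data.Nat using (ℕ; _≟_)
open import Data.Bool using (Bool; true; false; not; _∧_; _∨_)
open import Data.Maybe using (just; nothing)
open import Data.List using (List; []; _∷_; _++_)
open import Data.List.Membership.Propositional using (_∈_; _∉_)
open import Data.List.Membership.Propositional.Properties using (∈-++⁺ˡ; ∈-++⁺ʳ)
open import Data.List.Relation.Unary.Any using (here; there)
open import Data.Empty using (⊥-elim)
open import Function using (_∘′_)
open import Relation.Nullary using (yes; no)
open import Relation.Binary.PropositionalEquality using (_≡_; refl; sym; subst; cong₂)

module BooleanReasoning {Q : Set} where

  infix 2 _≤_
  _≤_ : BFm Q → BFm Q → Set
  x ≤ y = just (leaf x) ⊢ y

  private variable
    c x y z : BFm Q

  ≤-refl : x ≤ x
  ≤-refl = id _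

  ≤-trans : x ≤ y → y ≤ z → x ≤ z
  ≤-trans = cut {Γ = hole}

  ⊥-least : ⊥ᵇ ≤ x
  ⊥-least = ⊥L hole _

  ⊤-greatest : x ≤ ⊤ᵇ
  ⊤-greatest = ⊤R _

  x∧y≤x : x ∧ᵇ y ≤ x
  x∧y≤x = ∧L₁ {Γ = hole} ≤-refl

  x∧y≤y : x ∧ᵇ y ≤ y
  x∧y≤y = ∧L₂ {Γ = hole} ≤-refl

  ∨-lub : x ≤ z → y ≤ z → x ∨ᵇ y ≤ z
  ∨-lub = ∨L {Γ = hole}

  ∨-elim : c ≤ x ∨ᵇ y → c ∧ᵇ x ≤ z → c ∧ᵇ y ≤ z → c ≤ z
  ∨-elim {c} {x} {y} c≤x∨y p q =
    ≤-trans (∧R ≤-refl c≤x∨y) (≤-trans (distr c x y) (∨-lub p q))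

  by-cases : (y : BFm Q) → c ∧ᵇ y ≤ z → c ∧ᵇ ¬ᵇ y ≤ z → c ≤ z
  by-cases y = ∨-elim (≤-trans ⊤-greatest (lem y))

  contradiction : c ≤ x → c ≤ ¬ᵇ x → c ≤ ⊥ᵇ
  contradiction {x = x} p q = ≤-trans (∧R p q) (contra x)

  ¬-intro : c ∧ᵇ y ≤ ⊥ᵇ → c ≤ ¬ᵇ y
  ¬-intro {y = y} p = by-cases y (≤-trans p ⊥-least) x∧y≤y

  ¬¬-intro : x ≤ ¬ᵇ ¬ᵇ x
  ¬¬-intro {x} = ¬-intro (contra x)

  ¬-antitone : x ≤ y → ¬ᵇ y ≤ ¬ᵇ x
  ¬-antitone x≤y = ¬-intro (contradiction (≤-trans x∧y≤y x≤y) x∧y≤x)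

  ¬-∨ : c ≤ ¬ᵇ x → c ≤ ¬ᵇ y → c ≤ ¬ᵇ (x ∨ᵇ y)
  ¬-∨ p q = ¬-intro (∨-elim x∧y≤y
    (contradiction x∧y≤y (≤-trans (≤-trans x∧y≤x x∧y≤x) p))
    (contradiction x∧y≤y (≤-trans (≤-trans x∧y≤x x∧y≤x) q)))

  ⊃-elim : c ≤ x → c ≤ ¬ᵇ x ∨ᵇ y → c ≤ y
  ⊃-elim c≤x c≤x⊃y =
    ∨-elim c≤x⊃y (≤-trans (contradiction (≤-trans x∧y≤x c≤x) x∧y≤y) ⊥-least) x∧y≤y

  ≤⇒⊃ : x ≤ y → ⊤ᵇ ≤ ¬ᵇ x ∨ᵇ y
  ≤⇒⊃ {x} x≤y = by-cases x (∨R₂ (≤-trans x∧y≤y x≤y)) (∨R₁ x∧y≤y)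

  ⊃⇒≤ : ⊤ᵇ ≤ ¬ᵇ x ∨ᵇ y → x ≤ y
  ⊃⇒≤ p = ⊃-elim ≤-refl (≤-trans ⊤-greatest p)

  ·-monoʳ : x ≤ y → z · x ≤ z · y
  ·-monoʳ {z = z} x≤y = ·L {Γ = hole} (cut {Γ = leaf z ∘ᵣ hole} x≤y (·R ≤-refl ≤-refl))

  ·-distribˡ-∨ : z · (x ∨ᵇ y) ≤ z · x ∨ᵇ z · y
  ·-distribˡ-∨ {z} = ·L {Γ = hole} (∨L {Γ = leaf z ∘ᵣ hole}
    (∨R₁ (·R ≤-refl ≤-refl)) (∨R₂ (·R ≤-refl ≤-refl)))

  ·-zeroʳ : z · ⊥ᵇ ≤ ⊥ᵇ
  ·-zeroʳ {z} = ·L {Γ = hole} (⊥L (leaf z ∘ᵣ hole) ⊥ᵇ)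

open BooleanReasoning

module Tautologies {Q : Set} where

  _[_]ᵇ : PFm → (ℕ → BFm Q) → BFm Q
  pvar n [ τ ]ᵇ = τ n
  p⊥ [ τ ]ᵇ = ⊥ᵇ
  (φ p∧ ψ) [ τ ]ᵇ = (φ [ τ ]ᵇ) ∧ᵇ (ψ [ τ ]ᵇ)
  (φ p∨ ψ) [ τ ]ᵇ = (φ [ τ ]ᵇ) ∨ᵇ (ψ [ τ ]ᵇ)
  (φ p⊃ ψ) [ τ ]ᵇ = ¬ᵇ (φ [ τ ]ᵇ) ∨ᵇ (ψ [ τ ]ᵇ)

  vars : PFm → List ℕ
  vars (pvar n) = n ∷ []
  vars p⊥ = []
  vars (φ p∧ ψ) = vars φ ++ vars ψ
  vars (φ p∨ ψ) = vars φ ++ vars ψ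
  vars (φ p⊃ ψ) = vars φ ++ vars ψ

  literal : Bool → BFm Q → BFm Q
  literal true x = x
  literal false x = ¬ᵇ x

  private variable
    c x y : BFm Q

  literal-∧ : ∀ a b → c ≤ literal a x → c ≤ literal b y → c ≤ literal (a ∧ b) (x ∧ᵇ y)
  literal-∧ true true p q = ∧R p q
  literal-∧ true false p q = ≤-trans q (¬-antitone x∧y≤y)
  literal-∧ false b p q = ≤-trans p (¬-antitone x∧y≤x)

  literal-∨ : ∀ a b → c ≤ literal a x → c ≤ literal b y → c ≤ literal (a ∨ b) (x ∨ᵇ y)
  literal-∨ true b p q = ∨R₁ p
  literal-∨ false true p q = ∨R₂ q
  literal-∨ false false p q = ¬-∨ p q

  literal-⊃ : ∀ a b → c ≤ literal a x → c ≤ literal b y →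
              c ≤ literal (not a ∨ b) (¬ᵇ x ∨ᵇ y)
  literal-⊃ false b p q = ∨R₁ p
  literal-⊃ true true p q = ∨R₂ q
  literal-⊃ true false p q = ¬-∨ (≤-trans p ¬¬-intro) q

  module _ (τ : ℕ → BFm Q) where

    kalmar : ∀ φ v → (∀ n → n ∈ vars φ → c ≤ literal (v n) (τ n)) →
             c ≤ literal (⟦ φ ⟧ v) (φ [ τ ]ᵇ)
    kalmar (pvar n) v h = h n (here refl)
    kalmar p⊥ v h = ¬-intro x∧y≤y
    kalmar (φ p∧ ψ) v h = literal-∧ (⟦ φ ⟧ v) (⟦ ψ ⟧ v)
      (kalmar φ v (λ n → h n ∘′ ∈-++⁺ˡ)) (kalmar ψ v (λ n → h n ∘′ ∈-++⁺ʳ (vars φ)))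
    kalmar (φ p∨ ψ) v h = literal-∨ (⟦ φ ⟧ v) (⟦ ψ ⟧ v)
      (kalmar φ v (λ n → h n ∘′ ∈-++⁺ˡ)) (kalmar ψ v (λ n → h n ∘′ ∈-++⁺ʳ (vars φ)))
    kalmar (φ p⊃ ψ) v h = literal-⊃ (⟦ φ ⟧ v) (⟦ ψ ⟧ v)
      (kalmar φ v (λ n → h n ∘′ ∈-++⁺ˡ)) (kalmar ψ v (λ n → h n ∘′ ∈-++⁺ʳ (vars φ)))

    Decides : BFm Q → (ℕ → Bool) → PFm → List ℕ → Set
    Decides c v φ ws = ∀ n → n ∈ vars φ → n ∉ ws → c ≤ literal (v n) (τ n)

    update : (ℕ → Bool) → ℕ → Bool → ℕ → Bool
    update v w b n with n ≟ w
    ... | yes _ = b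
    ... | no _ = v n

    decides-∷ : ∀ φ {v w ws} → Decides c v φ (w ∷ ws) →
                (b : Bool) → Decides (c ∧ᵇ literal b (τ w)) (update v w b) φ ws
    decides-∷ φ {w = w} h b n n∈φ n∉ws with n ≟ w
    ... | yes refl = x∧y≤y
    ... | no n≢w =
      ≤-trans x∧y≤x (h n n∈φ λ { (here n≡w) → n≢w n≡w ; (there n∈ws) → n∉ws n∈ws })

    eliminate : ∀ φ → Tautology φ → ∀ ws {v} → Decides c v φ ws → c ≤ φ [ τ ]ᵇ
    eliminate {c} φ T [] {v} h =
      subst (λ b → c ≤ literal b (φ [ τ ]ᵇ)) (T v) (kalmar φ v (λ n n∈φ → h n n∈φ λ ()))
    eliminate φ T (w ∷ ws) h =
      by-cases (τ w) (eliminate φ T ws (decides-∷ φ h true))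
                     (eliminate φ T ws (decides-∷ φ h false))

    tautology-complete : ∀ φ → Tautology φ → ⊤ᵇ ≤ φ [ τ ]ᵇ
    tautology-complete φ T =
      eliminate φ T (vars φ) {λ _ → true} (λ n n∈φ n∉φ → ⊥-elim (n∉φ n∈φ))

open Tautologies

module _ {P : Set} where

  []-† : ∀ φ (σ : ℕ → MFm P) → (φ [ σ ]) † ≡ φ [ _† ∘′ σ ]ᵇ
  []-† (pvar n) σ = refl
  []-† p⊥ σ = refl
  []-† (φ p∧ ψ) σ = cong₂ _∧ᵇ_ ([]-† φ σ) ([]-† ψ σ)
  []-† (φ p∨ ψ) σ = cong₂ _∨ᵇ_ ([]-† φ σ) ([]-† ψ σ)
  []-† (φ p⊃ ψ) σ = cong₂ (λ x y → ¬ᵇ x ∨ᵇ y) ([]-† φ σ) ([]-† ψ σ)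

  ¬-⊃-split : PFm
  ¬-⊃-split = (pvar 1 p⊃ p⊥) p⊃ (((pvar 0 p⊃ pvar 1) p⊃ p⊥) p∨ (pvar 0 p⊃ p⊥))

  ¬-⊃-split-tautology : Tautology ¬-⊃-split
  ¬-⊃-split-tautology v with v 0 | v 1
  ... | _     | true  = refl
  ... | true  | false = refl
  ... | false | false = refl

  ∨-contrapositive : PFm
  ∨-contrapositive = (pvar 2 p⊃ (pvar 0 p∨ pvar 1)) p⊃
                     ((pvar 0 p⊃ p⊥) p⊃ ((pvar 1 p⊃ p⊥) p⊃ (pvar 2 p⊃ p⊥)))

  ∨-contrapositive-tautology : Tautology ∨-contrapositive
  ∨-contrapositive-tautology v with v 0 | v 1 | v 2
  ... | true  | true  | true  = refl
  ... | true  | true  | false = refl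
  ... | true  | false | true  = refl
  ... | true  | false | false = refl
  ... | false | true  | true  = refl
  ... | false | true  | false = refl
  ... | false | false | true  = refl
  ... | false | false | false = refl

  K-axiom-valid : (A B : MFm P) → ⊤ᵇ ≤ (□ (A ⊃ₘ B) ⊃ₘ (□ A ⊃ₘ □ B)) †
  K-axiom-valid A B =
    ⊃-elim (≤⇒⊃ ◇¬B≤◇¬[A⊃B]∨◇¬A)
           (tautology-complete (λ { 0 → ◇¬[A⊃B] ; 1 → ◇¬A ; _ → ◇¬B })
                               ∨-contrapositive ∨-contrapositive-tautology)
    where
    ¬[A⊃B] ¬A ¬B : BFm (Letter P)
    ¬[A⊃B] = ¬ᵇ (¬ᵇ (A †) ∨ᵇ B †) ∨ᵇ ⊥ᵇ
    ¬A = ¬ᵇ (A †) ∨ᵇ ⊥ᵇ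
    ¬B = ¬ᵇ (B †) ∨ᵇ ⊥ᵇ
    ◇¬[A⊃B] ◇¬A ◇¬B : BFm (Letter P)
    ◇¬[A⊃B] = atom m · ¬[A⊃B]
    ◇¬A = atom m · ¬A
    ◇¬B = atom m · ¬B
    ¬B≤¬[A⊃B]∨¬A : ¬B ≤ ¬[A⊃B] ∨ᵇ ¬A
    ¬B≤¬[A⊃B]∨¬A = ⊃⇒≤ (tautology-complete (λ { 0 → A † ; _ → B † })
                                           ¬-⊃-split ¬-⊃-split-tautology)
    ◇¬B≤◇¬[A⊃B]∨◇¬A : ◇¬B ≤ ◇¬[A⊃B] ∨ᵇ ◇¬A
    ◇¬B≤◇¬[A⊃B]∨◇¬A = ≤-trans (·-monoʳ ¬B≤¬[A⊃B]∨¬A) ·-distribˡ-∨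

  necessitation-valid : {A : MFm P} → ⊤ᵇ ≤ A † → ⊤ᵇ ≤ □ A †
  necessitation-valid {A} ⊤≤A = ≤⇒⊃ (≤-trans (·-monoʳ ¬A≤⊥) ·-zeroʳ)
    where
    ¬A≤⊥ : ¬ᵇ (A †) ∨ᵇ ⊥ᵇ ≤ ⊥ᵇ
    ¬A≤⊥ = ⊃-elim (≤-trans ⊤-greatest ⊤≤A) ≤-refl

  ⊢K⇒⊤≤† : {A : MFm P} → ⊢K A → ⊤ᵇ ≤ A †
  ⊢K⇒⊤≤† (taut φ T σ) = subst (⊤ᵇ ≤_) (sym ([]-† φ σ)) (tautology-complete (_† ∘′ σ) φ T)
  ⊢K⇒⊤≤† (kax A B) = K-axiom-valid A B
  ⊢K⇒⊤≤† (mp ⊢A ⊢A⊃B) = ⊃-elim (⊢K⇒⊤≤† ⊢A) (⊢K⇒⊤≤† ⊢A⊃B)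
  ⊢K⇒⊤≤† (nec ⊢A) = necessitation-valid (⊢K⇒⊤≤† ⊢A)

lemma3 : {P : Set} (A : MFm P) → ⊢K A → ⊢BFNL* (A †)
lemma3 A ⊢A = cut∅ (⊤R nothing) (⊢K⇒⊤≤† ⊢A)
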